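{- Let $k\ge2$ and $a,b\in\mathbb{N}$ with $a\ge k$, $b>k$, and such that $(a.b)$ is a factor of $\mathbf{W}^{(k)}$. For all $n\in\mathbb{N}$, \[ c^{(k)}((a.b);n)=\sum_{i=\max\{n-k+1,0\}}^{n-1}c^{(k)}((a.b);i)+c^{(k)}((a-k\,.\,b-k);n-k), \] where $c^{(k)}(\cdot\,;m)=0$ for $m<0$ and an empty sum is $0$.
   Context: Words are over the alphabet $\mathbb{N}=\{0,1,2,\dots\}$; $(x.y)$ denotes the length-2 word with letters $x,y$. For $k\ge 2$, $\phi_k$ is the morphism of $\mathbb{N}^*$ defined for $i\in\mathbb{N}$, $0\le j\le k-1$ by $\phi_k(ki+j)=(ki)(ki+j+1)$ if $0\le j\le k-2$ and $\phi_k(ki+k-1)=ki+k$; $W_n^{(k)}=\phi_k^n(0)$ and $\mathbf{W}^{(k)}=\lim_n\phi_k^n(0)$ is the infinite fixed point. For a nonempty word $B$, $c^{(k)}(B;n)$ is the number of (possibly overlapping) occurrences of $B$ as a factor of $W_n^{(k)}$. -}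

module Defs where

open import Data.Nat using (ℕ; zero; suc; _+_; _*_; _∸_; _<ᵇ_; _≡ᵇ_; _<_; NonZero)
open import Data.Nat.DivMod using (_/_; _%_)
open import Data.Bool using (Bool; true; false; if_then_else_; _∧_)
open import Data.List using (List; []; _∷_; concatMap; map; upTo)
open import Data.Nat.ListAction using (sum)
open import Data.Product using (∃)

-- The morphism φ_k on a single letter x = k*i + j (0 ≤ j ≤ k-1), k ≥ 1:
--   φ_k(k i + j) = (k i)(k i + j + 1)   if j ≤ k-2
--   φ_k(k i + k - 1) = k i + k
φ-letter : (k : ℕ) → .{{NonZero k}} → ℕ → List ℕ
φ-letter k x with (x % k) <ᵇ (k ∸ 1)
... | true  = (k * (x / k)) ∷ suc x ∷ []
... | false = suc x ∷ []

φ : (k : ℕ) → .{{NonZero k}} → List ℕ → List ℕ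
φ k w = concatMap (φ-letter k) w

W : (k : ℕ) → .{{NonZero k}} → ℕ → List ℕ
W k zero    = 0 ∷ []
W k (suc n) = φ k (W k n)

countPair : ℕ → ℕ → List ℕ → ℕ
countPair a b []            = 0
countPair a b (x ∷ [])      = 0
countPair a b (x ∷ y ∷ w)   =
  (if (x ≡ᵇ a) ∧ (y ≡ᵇ b) then 1 else 0) + countPair a b (y ∷ w)

c : (k : ℕ) → .{{NonZero k}} → ℕ → ℕ → ℕ → ℕ
c k a b n = countPair a b (W k n)

-- (a.b) is a factor of the infinite fixed point W^{(k)}: since every W_n is a
-- prefix of W^{(k)} and every prefix of W^{(k)} is a prefix of some W_n,
-- this is: (a.b) occurs in some W_n^{(k)}.
FactorOfW∞ : (k : ℕ) → .{{NonZero k}} → ℕ → ℕ → Set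
FactorOfW∞ k a b = ∃ λ (n : ℕ) → 0 < c k a b n

-- Σ_{i = max(n-k+1,0)}^{n-1} c((a.b); i)   (empty sum = 0)
-- indices i with n - k + 1 ≤ i ≤ n - 1, i ≥ 0: i.e. i = n ∸ (k ∸ 1) + t, t < n ∸ (n ∸ (k ∸ 1))
windowSum : (k : ℕ) → .{{NonZero k}} → ℕ → ℕ → ℕ → ℕ
windowSum k a b n =
  sum (map (λ t → c k a b ((n ∸ (k ∸ 1)) + t)) (upTo (n ∸ (n ∸ (k ∸ 1)))))

cShift : (k : ℕ) → .{{NonZero k}} → ℕ → ℕ → ℕ → ℕ
cShift k a b n = if n <ᵇ k then 0 else c k a b (n ∸ k)

{-# OPTIONS --safe #-}
-- Let Cₘ(j) count the occurrences of (a.b) in φᵐ(j), for j < k. For j < k − 1 we have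
-- φᵐ⁺¹(j) = φᵐ(0) φᵐ(j+1), while φᵐ⁺¹(k−1) = φᵐ(k) is φᵐ(0) with every letter raised by k.
-- Each φᵐ(j) with j < k begins with a letter ≤ k < b, so no occurrence straddles a junction:
-- Cₘ₊₁(j) = c((a.b); m) + Cₘ(j+1) and Cₘ₊₁(k−1) = c((a−k.b−k); m). Unfolding this cascade
-- k − 1 times, starting from c((a.b); n) = Cₙ(0), gives the identity.
module Submission where

open import Defs
open import Data.Bool using (true; false; if_then_else_; _∧_; T?)
open import Data.Bool.Properties using (∧-zeroʳ)
open import Data.List using (List; []; _∷_; _++_; map; concatMap; upTo; head; _∷ʳ_)
open import Data.List.Properties
  using (concatMap-++; concatMap-map; concatMap-cong; map-concatMap; map-++; upTo-∷ʳ)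
open import Data.Maybe using (just)
open import Data.Nat using (ℕ; zero; suc; _+_; _*_; _∸_; _≤_; _<_; _<ᵇ_; _≡ᵇ_; NonZero; s≤s; z≤n; z<s)
open import Data.Nat.DivMod using (_/_; _%_; [m+n]%n≡m%n; +-distrib-/-∣ˡ; n/n≡1; m<n⇒m%n≡m; m<n⇒m/n≡0)
open import Data.Nat.Divisibility using (∣-refl)
open import Data.Nat.ListAction using (sum)
open import Data.Nat.ListAction.Properties using (sum-++)
open import Data.Nat.Properties
open import Data.Product using (∃-syntax; _,_; proj₂)
open import Data.Sum using (inj₁; inj₂)
open import Function using (_∘_)
open import Relation.Binary.PropositionalEquality
open import Relation.Nullary.Decidable using (dec-true; dec-false)

open ≡-Reasoning

-- window f n e = Σ { f i ∣ max(n − e, 0) ≤ i < n }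
window : (ℕ → ℕ) → ℕ → ℕ → ℕ
window f n e = sum (map (λ t → f (n ∸ e + t)) (upTo (n ∸ (n ∸ e))))

delay : (ℕ → ℕ) → ℕ → ℕ → ℕ
delay g e n = if n <ᵇ e then 0 else g (n ∸ e)

window-zero : ∀ f e → window f 0 e ≡ 0
window-zero f e rewrite 0∸n≡0 e = refl

window-empty : ∀ f n → window f n 0 ≡ 0
window-empty f n rewrite n∸n≡0 n = refl

sum-map-∷ʳ : ∀ (g : ℕ → ℕ) xs x → sum (map g (xs ∷ʳ x)) ≡ sum (map g xs) + g x
sum-map-∷ʳ g xs x = begin
  sum (map g (xs ∷ʳ x))            ≡⟨ cong sum (map-++ g xs (x ∷ [])) ⟩
  sum (map g xs ++ g x ∷ [])       ≡⟨ sum-++ (map g xs) (g x ∷ []) ⟩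
  sum (map g xs) + (g x + 0)       ≡⟨ cong (sum (map g xs) +_) (+-identityʳ (g x)) ⟩
  sum (map g xs) + g x             ∎

window-suc : ∀ f n e → window f (suc n) (suc e) ≡ window f n e + f n
window-suc f n e = begin
  sum (map g (upTo (suc n ∸ s)))        ≡⟨ cong (sum ∘ map g ∘ upTo) (+-∸-assoc 1 s≤n) ⟩
  sum (map g (upTo (suc (n ∸ s))))      ≡⟨ cong (sum ∘ map g) (upTo-∷ʳ (n ∸ s)) ⟨
  sum (map g (upTo (n ∸ s) ∷ʳ (n ∸ s))) ≡⟨ sum-map-∷ʳ g (upTo (n ∸ s)) (n ∸ s) ⟩
  window f n e + f (s + (n ∸ s))        ≡⟨ cong (λ i → window f n e + f i) (m+[n∸m]≡n s≤n) ⟩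
  window f n e + f n                    ∎
  where
  s = n ∸ e
  s≤n = m∸n≤m n e
  g = λ t → f (s + t)

module Cascade (top : ℕ) (C : ℕ → ℕ → ℕ) (f g : ℕ → ℕ)
  (C-zero : ∀ j → C j 0 ≡ 0)
  (C-suc : ∀ m {j} → j < top → C j (suc m) ≡ f m + C (suc j) m)
  (C-top-suc : ∀ m → C top (suc m) ≡ g m)
  where

  unfold : ∀ e {j} → j + e ≡ top → ∀ m → C j m ≡ window f m e + delay g (suc e) m
  unfold e _ zero = trans (C-zero _) (sym (cong (_+ 0) (window-zero f e)))
  unfold zero {j} j+0≡top (suc m) = begin
    C j (suc m)                    ≡⟨ cong (λ i → C i (suc m)) (trans (sym (+-identityʳ j)) j+0≡top) ⟩
    C top (suc m)                  ≡⟨ C-top-suc m ⟩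
    g m                            ≡⟨ cong (_+ g m) (window-empty f (suc m)) ⟨
    window f (suc m) 0 + g m       ∎
  unfold (suc e) {j} j+1+e≡top (suc m) = begin
    C j (suc m)                              ≡⟨ C-suc m j<top ⟩
    f m + C (suc j) m                        ≡⟨ cong (f m +_) (unfold e (trans (sym (+-suc j e)) j+1+e≡top) m) ⟩
    f m + (window f m e + delay g (suc e) m) ≡⟨ +-assoc (f m) _ _ ⟨
    f m + window f m e + delay g (suc e) m   ≡⟨ cong (_+ delay g (suc e) m) (+-comm (f m) _) ⟩
    window f m e + f m + delay g (suc e) m   ≡⟨ cong (_+ delay g (suc e) m) (window-suc f m e) ⟨
    window f (suc m) (suc e) + delay g (suc (suc e)) (suc m) ∎
    where
    j<top : j < top
    j<top = subst (j <_) j+1+e≡top (m<m+n j z<s)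

countPair-++ : ∀ {a b} u v → head v ≢ just b →
               countPair a b (u ++ v) ≡ countPair a b u + countPair a b v
countPair-++ []           v       _   = refl
countPair-++ (x ∷ [])     []      _   = refl
countPair-++ {a} {b} (x ∷ []) (y ∷ v) y≢b
  rewrite dec-false (y ≟ b) (y≢b ∘ cong just) | ∧-zeroʳ (x ≡ᵇ a) = refl
countPair-++ {a} {b} (x ∷ x′ ∷ u) v h = begin
  i + countPair a b (x′ ∷ u ++ v)                       ≡⟨ cong (i +_) (countPair-++ (x′ ∷ u) v h) ⟩
  i + (countPair a b (x′ ∷ u) + countPair a b v)        ≡⟨ +-assoc i _ _ ⟨
  i + countPair a b (x′ ∷ u) + countPair a b v          ∎
  where i = if (x ≡ᵇ a) ∧ (x′ ≡ᵇ b) then 1 else 0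

+-≡ᵇ-∸ : ∀ {m o} n → m ≤ o → (m + n ≡ᵇ o) ≡ (n ≡ᵇ o ∸ m)
+-≡ᵇ-∸ n z≤n       = refl
+-≡ᵇ-∸ n (s≤s m≤o) = +-≡ᵇ-∸ n m≤o

countPair-shift : ∀ {k a b} → k ≤ a → k ≤ b → ∀ w →
                  countPair a b (map (k +_) w) ≡ countPair (a ∸ k) (b ∸ k) w
countPair-shift k≤a k≤b []          = refl
countPair-shift k≤a k≤b (x ∷ [])    = refl
countPair-shift k≤a k≤b (x ∷ y ∷ w) =
  cong₂ _+_ (cong₂ (λ p q → if p ∧ q then 1 else 0) (+-≡ᵇ-∸ x k≤a) (+-≡ᵇ-∸ y k≤b))
            (countPair-shift k≤a k≤b (y ∷ w))

module _ (k : ℕ) .{{_ : NonZero k}} where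

  φ^ : ℕ → List ℕ → List ℕ
  φ^ zero    w = w
  φ^ (suc m) w = φ k (φ^ m w)

  W≡φ^ : ∀ m → W k m ≡ φ^ m (0 ∷ [])
  W≡φ^ zero    = refl
  W≡φ^ (suc m) = cong (φ k) (W≡φ^ m)

  φ^-suc : ∀ m w → φ^ (suc m) w ≡ φ^ m (φ k w)
  φ^-suc zero    w = refl
  φ^-suc (suc m) w = cong (φ k) (φ^-suc m w)

  φ^-++ : ∀ m u v → φ^ m (u ++ v) ≡ φ^ m u ++ φ^ m v
  φ^-++ zero    u v = refl
  φ^-++ (suc m) u v = trans (cong (φ k) (φ^-++ m u v)) (concatMap-++ (φ-letter k) (φ^ m u) (φ^ m v))

  [k+x]%k : ∀ x → (k + x) % k ≡ x % k
  [k+x]%k x = trans (cong (_% k) (+-comm k x)) ([m+n]%n≡m%n x k)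

  k*[k+x]/k : ∀ x → k * ((k + x) / k) ≡ k + k * (x / k)
  k*[k+x]/k x = begin
    k * ((k + x) / k)     ≡⟨ cong (k *_) (+-distrib-/-∣ˡ x ∣-refl) ⟩
    k * (k / k + x / k)   ≡⟨ cong (λ q → k * (q + x / k)) (n/n≡1 k) ⟩
    k * suc (x / k)       ≡⟨ *-suc k (x / k) ⟩
    k + k * (x / k)       ∎

  φ-letter-shift : ∀ x → φ-letter k (k + x) ≡ map (k +_) (φ-letter k x)
  φ-letter-shift x rewrite [k+x]%k x with x % k <ᵇ k ∸ 1
  ... | true  = cong₂ _∷_ (k*[k+x]/k x) (cong (_∷ []) (sym (+-suc k x)))
  ... | false = cong (_∷ []) (sym (+-suc k x))

  φ-shift : ∀ w → φ k (map (k +_) w) ≡ map (k +_) (φ k w)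
  φ-shift w = begin
    φ k (map (k +_) w)                    ≡⟨ concatMap-map (φ-letter k) (k +_) w ⟩
    concatMap (φ-letter k ∘ (k +_)) w     ≡⟨ concatMap-cong φ-letter-shift w ⟩
    concatMap (map (k +_) ∘ φ-letter k) w ≡⟨ map-concatMap (k +_) (φ-letter k) w ⟨
    map (k +_) (φ k w)                    ∎

  φ^-shift : ∀ m w → φ^ m (map (k +_) w) ≡ map (k +_) (φ^ m w)
  φ^-shift zero    w = refl
  φ^-shift (suc m) w = trans (cong (φ k) (φ^-shift m w)) (φ-shift (φ^ m w))

φ-letter-< : ∀ {d j} → j < d → φ-letter (suc d) j ≡ 0 ∷ suc j ∷ []
φ-letter-< {d} {j} j<d
  rewrite m<n⇒m%n≡m {n = suc d} (m<n⇒m<1+n j<d) | dec-true (T? (j <ᵇ d)) (<⇒<ᵇ j<d)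
        | m<n⇒m/n≡0 {n = suc d} (m<n⇒m<1+n j<d) | *-zeroʳ d = refl

φ-letter-last : ∀ d → φ-letter (suc d) d ≡ suc d ∷ []
φ-letter-last d
  rewrite m<n⇒m%n≡m {n = suc d} (n<1+n d) | dec-false (T? (d <ᵇ d)) (n≮n d ∘ <ᵇ⇒< d d) = refl

module Iteration (d : ℕ) where

  k : ℕ
  k = 2 + d

  φ^-suc-< : ∀ m {j} → j < suc d → φ^ k (suc m) (j ∷ []) ≡ φ^ k m (0 ∷ []) ++ φ^ k m (suc j ∷ [])
  φ^-suc-< m {j} j<1+d = begin
    φ^ k (suc m) (j ∷ [])        ≡⟨ φ^-suc k m (j ∷ []) ⟩
    φ^ k m (φ-letter k j ++ [])  ≡⟨ cong (φ^ k m ∘ (_++ [])) (φ-letter-< j<1+d) ⟩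
    φ^ k m (0 ∷ suc j ∷ [])      ≡⟨ φ^-++ k m (0 ∷ []) (suc j ∷ []) ⟩
    φ^ k m (0 ∷ []) ++ φ^ k m (suc j ∷ []) ∎

  φ^-suc-last : ∀ m → φ^ k (suc m) (suc d ∷ []) ≡ map (k +_) (φ^ k m (0 ∷ []))
  φ^-suc-last m = begin
    φ^ k (suc m) (suc d ∷ [])          ≡⟨ φ^-suc k m (suc d ∷ []) ⟩
    φ^ k m (φ-letter k (suc d) ++ [])  ≡⟨ cong (φ^ k m ∘ (_++ [])) (φ-letter-last (suc d)) ⟩
    φ^ k m (k ∷ [])                    ≡⟨ cong (λ x → φ^ k m (x ∷ [])) (+-identityʳ k) ⟨
    φ^ k m (map (k +_) (0 ∷ []))       ≡⟨ φ^-shift k m (0 ∷ []) ⟩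
    map (k +_) (φ^ k m (0 ∷ []))       ∎

  φ^-0-starts-with-0 : ∀ m → ∃[ w ] φ^ k m (0 ∷ []) ≡ 0 ∷ w
  φ^-0-starts-with-0 zero = [] , refl
  φ^-0-starts-with-0 (suc m) with φ^-0-starts-with-0 m
  ... | w , eq = w ++ φ^ k m (1 ∷ []) , trans (φ^-suc-< m z<s) (cong (_++ φ^ k m (1 ∷ [])) eq)

  head-φ^-≢ : ∀ {b} → k < b → ∀ m {j} → j < k → head (φ^ k m (j ∷ [])) ≢ just b
  head-φ^-≢ k<b zero    j<k refl = <-asym j<k k<b
  head-φ^-≢ k<b (suc m) (s≤s j≤1+d) with m≤n⇒m<n∨m≡n j≤1+d
  ... | inj₁ j<1+d rewrite φ^-suc-< m j<1+d | proj₂ (φ^-0-starts-with-0 m) =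
    λ { refl → n≮0 k<b }
  ... | inj₂ refl  rewrite φ^-suc-last m | proj₂ (φ^-0-starts-with-0 m) | +-identityʳ k =
    λ { refl → n≮n k k<b }

  module Counting {a b} (k≤a : k ≤ a) (k<b : k < b) where

    C : ℕ → ℕ → ℕ
    C j m = countPair a b (φ^ k m (j ∷ []))

    C-suc : ∀ m {j} → j < suc d → C j (suc m) ≡ c k a b m + C (suc j) m
    C-suc m {j} j<1+d = begin
      countPair a b (φ^ k (suc m) (j ∷ []))                   ≡⟨ cong (countPair a b) (φ^-suc-< m j<1+d) ⟩
      countPair a b (φ^ k m (0 ∷ []) ++ φ^ k m (suc j ∷ []))  ≡⟨ countPair-++ (φ^ k m (0 ∷ [])) _ (head-φ^-≢ k<b m (s≤s j<1+d)) ⟩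
      countPair a b (φ^ k m (0 ∷ [])) + C (suc j) m           ≡⟨ cong (λ w → countPair a b w + C (suc j) m) (W≡φ^ k m) ⟨
      c k a b m + C (suc j) m                                 ∎

    C-suc-last : ∀ m → C (suc d) (suc m) ≡ c k (a ∸ k) (b ∸ k) m
    C-suc-last m = begin
      countPair a b (φ^ k (suc m) (suc d ∷ []))          ≡⟨ cong (countPair a b) (φ^-suc-last m) ⟩
      countPair a b (map (k +_) (φ^ k m (0 ∷ [])))       ≡⟨ countPair-shift k≤a (<⇒≤ k<b) (φ^ k m (0 ∷ [])) ⟩
      countPair (a ∸ k) (b ∸ k) (φ^ k m (0 ∷ []))        ≡⟨ cong (countPair (a ∸ k) (b ∸ k)) (W≡φ^ k m) ⟨
      c k (a ∸ k) (b ∸ k) m                              ∎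

    open Cascade (suc d) C (c k a b) (c k (a ∸ k) (b ∸ k)) (λ _ → refl) C-suc C-suc-last public

proposition5p12 : (k : ℕ) → .{{_ : NonZero k}} → 2 ≤ k → (a b : ℕ) → k ≤ a → k < b →
                  FactorOfW∞ k a b →
                  (n : ℕ) → c k a b n ≡ windowSum k a b n + cShift k (a ∸ k) (b ∸ k) n
proposition5p12 k@(suc (suc d)) (s≤s (s≤s z≤n)) a b k≤a k<b _ n = begin
  c k a b n                                           ≡⟨ cong (countPair a b) (W≡φ^ k n) ⟩
  C 0 n                                               ≡⟨ unfold (suc d) refl n ⟩
  window (c k a b) n (suc d) + delay (c k (a ∸ k) (b ∸ k)) k n ≡⟨⟩
  windowSum k a b n + cShift k (a ∸ k) (b ∸ k) n                ∎
  where open Iteration.Counting d k≤a k<b
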